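{- For every integer $k \geq 1$, let $\mathcal{Q}(k)$ denote the greatest common divisor of all the integers $\sum_{i=1}^{k} Q_{n+i}$ for $n \geq 0$. Then $$\mathcal{Q}(k) = \begin{cases} 2P_{k/2}, & \text{if } k \equiv 0 \pmod 4;\\ 2Q_{k/2}, & \text{if } k \equiv 2 \pmod 4;\\ 1, & \text{if } k \equiv 1,3 \pmod 4.\end{cases}$$
   Context: The Pell sequence $(P_n)_{n\ge 0}$ is defined by $P_0=0$, $P_1=1$, $P_n=2P_{n-1}+P_{n-2}$ for $n\ge 2$. The associated Pell sequence $(Q_n)_{n\ge 0}$ is defined by $Q_0=1$, $Q_1=1$, $Q_n=2Q_{n-1}+Q_{n-2}$ for $n\ge 2$. -}

module Defs where

open import Data.Nat using (ℕ; zero; suc; _+_; _*_)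
open import Data.Nat.Divisibility using (_∣_)
open import Data.Product using (_×_)

P : ℕ → ℕ
P zero = 0
P (suc zero) = 1
P (suc (suc n)) = 2 * P (suc n) + P n

Q : ℕ → ℕ
Q zero = 1
Q (suc zero) = 1
Q (suc (suc n)) = 2 * Q (suc n) + Q n

sumQ : ℕ → ℕ → ℕ
sumQ zero n = 0
sumQ (suc k) n = sumQ k n + Q (n + suc k)

IsGCDOfFamily : (ℕ → ℕ) → ℕ → Set
IsGCDOfFamily f g = (∀ n → g ∣ f n) × (∀ d → (∀ n → d ∣ f n) → d ∣ g)

-- A sum of k consecutive terms telescopes: Σ_{i=1}^{k} Q_{n+i} = P_{n+1+k} − P_{n+1}.
-- For even k = 2j the addition formulas and the Pell equation Q_j² − 2P_j² = ±1 turn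
-- this difference into 2P_j·Q_{n+1+j} (j even) or 2Q_j·P_{n+1+j} (j odd).  A common
-- divisor of c·u_N and c·u_{N+1}, for u solving u_{n+2} = 2u_{n+1} + u_n, divides every
-- earlier c·u_n, in particular c·u_1 = c; so the gcd is exactly 2P_j, resp. 2Q_j.
-- For odd k, a common divisor d of all the sums divides P_k, and P_{k+1} ≡ 1 (mod d);
-- Cassini's identity P_{k+1}² + 1 = P_k·P_{k+2} then forces d ∣ 2, while P_k is odd.
module Submission where

open import Defs
open import Data.Nat using (ℕ; zero; suc; _+_; _*_)
open import Data.Nat.Properties using (+-identityʳ; +-cancelʳ-≡; +-suc; +-assoc; *-identityʳ)
open import Data.Nat.Divisibility
  using (_∣_; 1∣_; m∣m*n; ∣m⇒∣m*n; ∣n⇒∣m*n; ∣m+n∣m⇒∣n)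
open import Data.Nat.Tactic.RingSolver using (solve-∀; solve)
open import Data.List using (_∷_; [])
open import Data.Product using (_×_; _,_; ∃-syntax; proj₁)
open import Relation.Binary.PropositionalEquality
  using (_≡_; refl; sym; trans; cong; cong₂; subst)
open Relation.Binary.PropositionalEquality.≡-Reasoning

record Recurrent (a : ℕ) (u : ℕ → ℕ) : Set where
  constructor recurrent
  field step : ∀ n → u (2 + n) ≡ a * u (1 + n) + u n

open Recurrent

module _ {a : ℕ} where

  Recurrent-+ : ∀ {u v} → Recurrent a u → Recurrent a v →
                Recurrent a (λ n → u n + v n)
  Recurrent-+ {u} {v} ru rv = recurrent λ n → begin
    u (2 + n) + v (2 + n)                          ≡⟨ cong₂ _+_ (step ru n) (step rv n) ⟩
    a * u (1 + n) + u n + (a * v (1 + n) + v n)    ≡⟨ distrib a (u (1 + n)) (u n) (v (1 + n)) (v n) ⟩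
    a * (u (1 + n) + v (1 + n)) + (u n + v n)      ∎
    where
    distrib : ∀ a x y z w → a * x + y + (a * z + w) ≡ a * (x + z) + (y + w)
    distrib = solve-∀

  Recurrent-* : ∀ c {u} → Recurrent a u → Recurrent a (λ n → c * u n)
  Recurrent-* c {u} ru = recurrent λ n → begin
    c * u (2 + n)                      ≡⟨ cong (c *_) (step ru n) ⟩
    c * (a * u (1 + n) + u n)          ≡⟨ distrib c a (u (1 + n)) (u n) ⟩
    a * (c * u (1 + n)) + c * u n      ∎
    where
    distrib : ∀ c a x y → c * (a * x + y) ≡ a * (c * x) + c * y
    distrib = solve-∀

  Recurrent-shift : ∀ s {u} → Recurrent a u → Recurrent a (λ n → u (n + s))
  Recurrent-shift s ru = recurrent λ n → step ru (n + s)

  Recurrent-unique : ∀ {u v} → Recurrent a u → Recurrent a v →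
                     u 0 ≡ v 0 → u 1 ≡ v 1 → ∀ n → u n ≡ v n
  Recurrent-unique {u} {v} ru rv u₀ u₁ n = proj₁ (agree n)
    where
    agree : ∀ n → u n ≡ v n × u (1 + n) ≡ v (1 + n)
    agree zero    = u₀ , u₁
    agree (suc n) with agree n
    ... | uₙ , uₙ₊₁ = uₙ₊₁ , trans (step ru n) (trans (cong₂ (λ x y → a * x + y) uₙ₊₁ uₙ) (sym (step rv n)))

  common-∣-descends : ∀ {u d} → Recurrent a u → ∀ n → d ∣ u n → d ∣ u (1 + n) → d ∣ u 1
  common-∣-descends ru zero    _     d∣u₁   = d∣u₁
  common-∣-descends ru (suc n) d∣uₙ₊₁ d∣uₙ₊₂ =
    common-∣-descends ru n (∣m+n∣m⇒∣n (subst (_ ∣_) (step ru n) d∣uₙ₊₂) (∣n⇒∣m*n a d∣uₙ₊₁)) d∣uₙ₊₁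

IsGCDOfFamily-resp : ∀ {f g c} → (∀ n → f n ≡ g n) → IsGCDOfFamily f c → IsGCDOfFamily g c
IsGCDOfFamily-resp f≗g (c∣f , greatest) =
  (λ n → subst (_ ∣_) (f≗g n) (c∣f n)) ,
  (λ d d∣g → greatest d (λ n → subst (_ ∣_) (sym (f≗g n)) (d∣g n)))

Recurrent⇒IsGCDOfFamily : ∀ {a u} → Recurrent a u → u 1 ≡ 1 →
                          ∀ c s → IsGCDOfFamily (λ n → c * u (n + s)) c
Recurrent⇒IsGCDOfFamily {u = u} ru u₁≡1 c s = (λ n → m∣m*n (u (n + s))) , greatest
  where
  greatest : ∀ d → (∀ n → d ∣ c * u (n + s)) → d ∣ c
  greatest d d∣cu = subst (d ∣_) (trans (cong (c *_) u₁≡1) (*-identityʳ c))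
    (common-∣-descends (Recurrent-* c ru) s (d∣cu 0) (d∣cu 1))

P-rec : Recurrent 2 P
P-rec = recurrent λ _ → refl

Q-rec : Recurrent 2 Q
Q-rec = recurrent λ _ → refl

P-suc : ∀ n → P (suc n) ≡ P n + Q n
P-suc = Recurrent-unique (recurrent λ _ → refl) (Recurrent-+ P-rec Q-rec) refl refl

Q-suc : ∀ n → Q (suc n) ≡ Q n + 2 * P n
Q-suc = Recurrent-unique (recurrent λ _ → refl) (Recurrent-+ Q-rec (Recurrent-* 2 P-rec)) refl refl

P-+ : ∀ m n → P (m + n) ≡ Q n * P m + P n * Q m
P-+ m n = Recurrent-unique (Recurrent-shift n P-rec)
  (Recurrent-+ (Recurrent-* (Q n) P-rec) (Recurrent-* (P n) Q-rec))
  (sym (base₀ (Q n) (P n))) (trans (P-suc n) (base₁ (P n) (Q n))) m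
  where
  base₀ : ∀ q p → q * 0 + p * 1 ≡ p
  base₀ = solve-∀
  base₁ : ∀ p q → p + q ≡ q * 1 + p * 1
  base₁ = solve-∀

Q-+ : ∀ m n → Q (m + n) ≡ Q n * Q m + 2 * P n * P m
Q-+ m n = Recurrent-unique (Recurrent-shift n Q-rec)
  (Recurrent-+ (Recurrent-* (Q n) Q-rec) (Recurrent-* (2 * P n) P-rec))
  (sym (base₀ (Q n) (P n))) (trans (Q-suc n) (base₁ (P n) (Q n))) m
  where
  base₀ : ∀ q p → q * 1 + 2 * p * 0 ≡ q
  base₀ = solve-∀
  base₁ : ∀ p q → q + 2 * p ≡ q * 1 + 2 * p * 1
  base₁ = solve-∀

Pell⁺ Pell⁻ : ℕ → Set
Pell⁺ n = Q n * Q n ≡ 2 * (P n * P n) + 1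
Pell⁻ n = 2 * (P n * P n) ≡ Q n * Q n + 1

-- (q, p) ↦ (q + 2p, p + q) is multiplication by 1 + √2, whose norm is −1.
Pell⁺⇒Pell⁻ : ∀ n → Pell⁺ n → Pell⁻ (suc n)
Pell⁺⇒Pell⁻ n pell rewrite P-suc n | Q-suc n = algebra (P n) (Q n) pell
  where
  algebra : ∀ p q → q * q ≡ 2 * (p * p) + 1 → 2 * ((p + q) * (p + q)) ≡ (q + 2 * p) * (q + 2 * p) + 1
  algebra p q pell = +-cancelʳ-≡ (2 * (p * p)) _ _ (begin
    2 * ((p + q) * (p + q)) + 2 * (p * p)          ≡⟨ solve (p ∷ q ∷ []) ⟩
    (q + 2 * p) * (q + 2 * p) + q * q              ≡⟨ cong ((q + 2 * p) * (q + 2 * p) +_) pell ⟩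
    (q + 2 * p) * (q + 2 * p) + (2 * (p * p) + 1)  ≡⟨ solve (p ∷ q ∷ []) ⟩
    (q + 2 * p) * (q + 2 * p) + 1 + 2 * (p * p)    ∎)

Pell⁻⇒Pell⁺ : ∀ n → Pell⁻ n → Pell⁺ (suc n)
Pell⁻⇒Pell⁺ n pell rewrite P-suc n | Q-suc n = algebra (P n) (Q n) pell
  where
  algebra : ∀ p q → 2 * (p * p) ≡ q * q + 1 → (q + 2 * p) * (q + 2 * p) ≡ 2 * ((p + q) * (p + q)) + 1
  algebra p q pell = +-cancelʳ-≡ (q * q) _ _ (begin
    (q + 2 * p) * (q + 2 * p) + q * q              ≡⟨ solve (p ∷ q ∷ []) ⟩
    2 * ((p + q) * (p + q)) + 2 * (p * p)          ≡⟨ cong (2 * ((p + q) * (p + q)) +_) pell ⟩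
    2 * ((p + q) * (p + q)) + (q * q + 1)          ≡⟨ solve (p ∷ q ∷ []) ⟩
    2 * ((p + q) * (p + q)) + 1 + q * q            ∎)

pell⁺ : ∀ t → Pell⁺ (2 * t)
pell⁻ : ∀ t → Pell⁻ (1 + 2 * t)

pell⁺ zero    = refl
pell⁺ (suc t) = subst Pell⁺ (index t) (Pell⁻⇒Pell⁺ (1 + 2 * t) (pell⁻ t))
  where
  index : ∀ t → 2 + 2 * t ≡ 2 * (1 + t)
  index = solve-∀
pell⁻ t = Pell⁺⇒Pell⁻ (2 * t) (pell⁺ t)

sumQ+P≡P : ∀ k n → sumQ k n + P (suc n) ≡ P (suc n + k)
sumQ+P≡P zero    n = cong P (sym (+-identityʳ (suc n)))
sumQ+P≡P (suc k) n = begin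
  sumQ k n + Q (n + suc k) + P (suc n)    ≡⟨ swap (sumQ k n) _ _ ⟩
  sumQ k n + P (suc n) + Q (n + suc k)    ≡⟨ cong₂ _+_ (sumQ+P≡P k n) (cong Q (+-suc n k)) ⟩
  P (suc n + k) + Q (suc n + k)           ≡⟨ sym (P-suc (suc n + k)) ⟩
  P (suc (suc n + k))                     ≡⟨ cong (λ i → P (suc i)) (sym (+-suc n k)) ⟩
  P (suc n + suc k)                       ∎
  where
  swap : ∀ x y z → x + y + z ≡ x + z + y
  swap = solve-∀

P-+-expand : ∀ m j → P (m + j + j) ≡ Q j * (Q j * P m + P j * Q m) + P j * (Q j * Q m + 2 * P j * P m)
P-+-expand m j = trans (P-+ (m + j) j) (cong₂ (λ x y → Q j * x + P j * y) (P-+ m j) (Q-+ m j))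

P-+-double⁺ : ∀ j → Pell⁺ j → ∀ m → P (m + j + j) ≡ 2 * P j * Q (m + j) + P m
P-+-double⁺ j pell m = begin
  P (m + j + j)                                ≡⟨ P-+-expand m j ⟩
  _                                            ≡⟨ algebra (P j) (Q j) (P m) (Q m) pell ⟩
  2 * P j * (Q j * Q m + 2 * P j * P m) + P m  ≡⟨ cong (λ y → 2 * P j * y + P m) (sym (Q-+ m j)) ⟩
  2 * P j * Q (m + j) + P m                    ∎
  where
  algebra : ∀ p q x y → q * q ≡ 2 * (p * p) + 1 →
            q * (q * x + p * y) + p * (q * y + 2 * p * x) ≡ 2 * p * (q * y + 2 * p * x) + x
  algebra p q x y pell = begin
    q * (q * x + p * y) + p * (q * y + 2 * p * x)    ≡⟨ solve (p ∷ q ∷ x ∷ y ∷ []) ⟩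
    q * q * x + 2 * p * (q * y + p * x)              ≡⟨ cong (λ s → s * x + 2 * p * (q * y + p * x)) pell ⟩
    (2 * (p * p) + 1) * x + 2 * p * (q * y + p * x)  ≡⟨ solve (p ∷ q ∷ x ∷ y ∷ []) ⟩
    2 * p * (q * y + 2 * p * x) + x                  ∎

P-+-double⁻ : ∀ j → Pell⁻ j → ∀ m → P (m + j + j) ≡ 2 * Q j * P (m + j) + P m
P-+-double⁻ j pell m = begin
  P (m + j + j)                                ≡⟨ P-+-expand m j ⟩
  _                                            ≡⟨ algebra (P j) (Q j) (P m) (Q m) pell ⟩
  2 * Q j * (Q j * P m + P j * Q m) + P m      ≡⟨ cong (λ y → 2 * Q j * y + P m) (sym (P-+ m j)) ⟩
  2 * Q j * P (m + j) + P m                    ∎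
  where
  algebra : ∀ p q x y → 2 * (p * p) ≡ q * q + 1 →
            q * (q * x + p * y) + p * (q * y + 2 * p * x) ≡ 2 * q * (q * x + p * y) + x
  algebra p q x y pell = begin
    q * (q * x + p * y) + p * (q * y + 2 * p * x)  ≡⟨ solve (p ∷ q ∷ x ∷ y ∷ []) ⟩
    q * q * x + 2 * p * q * y + 2 * (p * p) * x    ≡⟨ cong (λ s → q * q * x + 2 * p * q * y + s * x) pell ⟩
    q * q * x + 2 * p * q * y + (q * q + 1) * x    ≡⟨ solve (p ∷ q ∷ x ∷ y ∷ []) ⟩
    2 * q * (q * x + p * y) + x                    ∎

sumQ[j+j]+P≡P : ∀ j n → sumQ (j + j) n + P (suc n) ≡ P (suc n + j + j)
sumQ[j+j]+P≡P j n = trans (sumQ+P≡P (j + j) n) (cong P (sym (+-assoc (suc n) j j)))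

sumQ-double⁺ : ∀ j → Pell⁺ j → ∀ n → sumQ (j + j) n ≡ 2 * P j * Q (n + suc j)
sumQ-double⁺ j pell n = +-cancelʳ-≡ (P (suc n)) _ _ (begin
  sumQ (j + j) n + P (suc n)            ≡⟨ sumQ[j+j]+P≡P j n ⟩
  P (suc n + j + j)                     ≡⟨ P-+-double⁺ j pell (suc n) ⟩
  2 * P j * Q (suc n + j) + P (suc n)   ≡⟨ cong (λ i → 2 * P j * Q i + P (suc n)) (sym (+-suc n j)) ⟩
  2 * P j * Q (n + suc j) + P (suc n)   ∎)

sumQ-double⁻ : ∀ j → Pell⁻ j → ∀ n → sumQ (j + j) n ≡ 2 * Q j * P (n + suc j)
sumQ-double⁻ j pell n = +-cancelʳ-≡ (P (suc n)) _ _ (begin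
  sumQ (j + j) n + P (suc n)            ≡⟨ sumQ[j+j]+P≡P j n ⟩
  P (suc n + j + j)                     ≡⟨ P-+-double⁻ j pell (suc n) ⟩
  2 * Q j * P (suc n + j) + P (suc n)   ≡⟨ cong (λ i → 2 * Q j * P i + P (suc n)) (sym (+-suc n j)) ⟩
  2 * Q j * P (n + suc j) + P (suc n)   ∎)

sumQ-gcd⁺ : ∀ j → Pell⁺ j → IsGCDOfFamily (sumQ (j + j)) (2 * P j)
sumQ-gcd⁺ j pell = IsGCDOfFamily-resp (λ n → sym (sumQ-double⁺ j pell n))
  (Recurrent⇒IsGCDOfFamily Q-rec refl (2 * P j) (suc j))

sumQ-gcd⁻ : ∀ j → Pell⁻ j → IsGCDOfFamily (sumQ (j + j)) (2 * Q j)
sumQ-gcd⁻ j pell = IsGCDOfFamily-resp (λ n → sym (sumQ-double⁻ j pell n))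
  (Recurrent⇒IsGCDOfFamily P-rec refl (2 * Q j) (suc j))

sumQ[k,1] : ∀ k → sumQ k 1 ≡ 2 * sumQ k 0 + P k
sumQ[k,1] k = +-cancelʳ-≡ 2 _ _ (begin
  sumQ k 1 + 2                ≡⟨ sumQ+P≡P k 1 ⟩
  2 * P (suc k) + P k         ≡⟨ cong (λ x → 2 * x + P k) (sym (sumQ+P≡P k 0)) ⟩
  2 * (sumQ k 0 + 1) + P k    ≡⟨ regroup (sumQ k 0) (P k) ⟩
  2 * sumQ k 0 + P k + 2      ∎)
  where
  regroup : ∀ x y → 2 * (x + 1) + y ≡ 2 * x + y + 2
  regroup = solve-∀

cassini⁻ : ∀ k → Pell⁻ k → P (suc k) * P (suc k) + 1 ≡ P k * P (2 + k)
cassini⁻ k pell rewrite P-suc k = algebra (P k) (Q k) pell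
  where
  algebra : ∀ p q → 2 * (p * p) ≡ q * q + 1 → (p + q) * (p + q) + 1 ≡ p * (2 * (p + q) + p)
  algebra p q pell = begin
    (p + q) * (p + q) + 1            ≡⟨ solve (p ∷ q ∷ []) ⟩
    p * p + 2 * p * q + (q * q + 1)  ≡⟨ cong (p * p + 2 * p * q +_) (sym pell) ⟩
    p * p + 2 * p * q + 2 * (p * p)  ≡⟨ solve (p ∷ q ∷ []) ⟩
    p * (2 * (p + q) + p)            ∎

∣x∧∣[x+1]²+1⇒∣2 : ∀ {d} x → d ∣ x → d ∣ (x + 1) * (x + 1) + 1 → d ∣ 2
∣x∧∣[x+1]²+1⇒∣2 {d} x d∣x d∣y = ∣m+n∣m⇒∣n (subst (d ∣_) (expand x) d∣y) (∣m⇒∣m*n (x + 2) d∣x)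
  where
  expand : ∀ x → (x + 1) * (x + 1) + 1 ≡ x * (x + 2) + 2
  expand = solve-∀

∣2∧∣odd⇒∣1 : ∀ {d} r → d ∣ 2 → d ∣ 2 * r + 1 → d ∣ 1
∣2∧∣odd⇒∣1 r d∣2 d∣odd = ∣m+n∣m⇒∣n d∣odd (∣m⇒∣m*n r d∣2)

P-odd : ∀ t → ∃[ r ] P (1 + 2 * t) ≡ 2 * r + 1
P-odd zero    = 0 , refl
P-odd (suc t) with P-odd t
... | r , P≡2r+1 = P (2 + 2 * t) + r , (begin
  P (1 + 2 * (1 + t))                  ≡⟨ cong P (index t) ⟩
  2 * P (2 + 2 * t) + P (1 + 2 * t)    ≡⟨ cong (2 * P (2 + 2 * t) +_) P≡2r+1 ⟩
  2 * P (2 + 2 * t) + (2 * r + 1)      ≡⟨ regroup (P (2 + 2 * t)) r ⟩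
  2 * (P (2 + 2 * t) + r) + 1          ∎)
  where
  index : ∀ t → 1 + 2 * (1 + t) ≡ 3 + 2 * t
  index = solve-∀
  regroup : ∀ x r → 2 * x + (2 * r + 1) ≡ 2 * (x + r) + 1
  regroup = solve-∀

sumQ-gcd-odd : ∀ k → Pell⁻ k → ∃[ r ] P k ≡ 2 * r + 1 → IsGCDOfFamily (sumQ k) 1
sumQ-gcd-odd k pell (r , odd) = (λ n → 1∣ sumQ k n) , greatest
  where
  greatest : ∀ d → (∀ n → d ∣ sumQ k n) → d ∣ 1
  greatest d d∣sumQ = ∣2∧∣odd⇒∣1 r d∣2 (subst (d ∣_) odd d∣Pk)
    where
    d∣Pk : d ∣ P k
    d∣Pk = ∣m+n∣m⇒∣n (subst (d ∣_) (sumQ[k,1] k) (d∣sumQ 1)) (∣n⇒∣m*n 2 (d∣sumQ 0))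
    cassini : P k * P (2 + k) ≡ (sumQ k 0 + 1) * (sumQ k 0 + 1) + 1
    cassini = trans (sym (cassini⁻ k pell)) (cong (λ x → x * x + 1) (sym (sumQ+P≡P k 0)))
    d∣2 : d ∣ 2
    d∣2 = ∣x∧∣[x+1]²+1⇒∣2 (sumQ k 0) (d∣sumQ 0) (subst (d ∣_) cassini (∣m⇒∣m*n (P (2 + k)) d∣Pk))

theorem16 : (m : ℕ) →
    IsGCDOfFamily (sumQ (4 * m + 4)) (2 * P (2 * m + 2)) ×
    IsGCDOfFamily (sumQ (4 * m + 2)) (2 * Q (2 * m + 1)) ×
    IsGCDOfFamily (sumQ (4 * m + 1)) 1 ×
    IsGCDOfFamily (sumQ (4 * m + 3)) 1
theorem16 m =
    reindex (k≡4m+4 m) (sumQ-gcd⁺ (2 * m + 2) (subst Pell⁺ (j≡2m+2 m) (pell⁺ (1 + m))))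
  , reindex (k≡4m+2 m) (sumQ-gcd⁻ (2 * m + 1) (subst Pell⁻ (j≡2m+1 m) (pell⁻ m)))
  , reindex (k≡4m+1 m) (sumQ-gcd-odd (1 + 2 * (2 * m)) (pell⁻ (2 * m)) (P-odd (2 * m)))
  , reindex (k≡4m+3 m) (sumQ-gcd-odd (1 + 2 * (1 + 2 * m)) (pell⁻ (1 + 2 * m)) (P-odd (1 + 2 * m)))
  where
  reindex : ∀ {k k′ c} → k ≡ k′ → IsGCDOfFamily (sumQ k) c → IsGCDOfFamily (sumQ k′) c
  reindex {c = c} = subst (λ k → IsGCDOfFamily (sumQ k) c)
  j≡2m+2 : ∀ m → 2 * (1 + m) ≡ 2 * m + 2
  j≡2m+2 = solve-∀
  j≡2m+1 : ∀ m → 1 + 2 * m ≡ 2 * m + 1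
  j≡2m+1 = solve-∀
  k≡4m+4 : ∀ m → (2 * m + 2) + (2 * m + 2) ≡ 4 * m + 4
  k≡4m+4 = solve-∀
  k≡4m+2 : ∀ m → (2 * m + 1) + (2 * m + 1) ≡ 4 * m + 2
  k≡4m+2 = solve-∀
  k≡4m+1 : ∀ m → 1 + 2 * (2 * m) ≡ 4 * m + 1
  k≡4m+1 = solve-∀
  k≡4m+3 : ∀ m → 1 + 2 * (1 + 2 * m) ≡ 4 * m + 3
  k≡4m+3 = solve-∀
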